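{- Let $V$ be a finite set and let $f:\mathcal{G}(V)\to\mathbb{R}$ be a subadditive function. Let $K\in\mathbb{R}$ be such that $f(S)\le K$ for every $S\in\mathcal{S}(V)$. Then for every $G\in\mathcal{G}(V)$, $f(G)\le K\cdot\tau(G)$.
   Context: $\mathcal{G}(V)$ is the collection of all simple graphs with vertex set $V$. A function $f:\mathcal{G}(V)\to\mathbb{R}$ is subadditive if $f(G_1\cup G_2)\le f(G_1)+f(G_2)$ for all edge-disjoint $G_1,G_2\in\mathcal{G}(V)$. $\mathcal{S}(V)\subset\mathcal{G}(V)$ is the set of graphs on $V$ whose edges form a star (a star graph plus possibly isolated vertices). $\tau(G)$ is the covering number of $G$: the minimum size of a set $U\subset V$ meeting every edge. -}

module Defs where

open import Level using (Level; _⊔_) renaming (suc to lsuc)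
open import Data.Nat as ℕ using (ℕ; zero; suc)
open import Data.Bool using (Bool; true; false; _∨_; _∧_; T)
open import Data.Unit using (⊤; tt)
open import Data.Empty using (⊥)
open import Data.Product using (_×_; _,_; ∃; ∃-syntax; Σ-syntax)
open import Data.Sum using (_⊎_)
open import Data.Fin using (Fin; zero; suc)
open import Data.Fin.Subset using (Subset; _∈_; ∣_∣)
open import Data.Vec using (Vec; []; _∷_; lookup; zipWith)
open import Relation.Binary.PropositionalEquality using (_≡_)

-- Codomain: ℝ is not available in agda-stdlib.  We work over an arbitrary
-- totally ordered abelian group (with propositional equality); ℝ with its
-- usual + and ≤ is an instance.

record OrderedAbelianGroup (a ℓ : Level) : Set (lsuc (a ⊔ ℓ)) where
  infixl 6 _+_
  infix  4 _≤_
  field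
    Carrier   : Set a
    _+_       : Carrier → Carrier → Carrier
    0#        : Carrier
    -_        : Carrier → Carrier
    _≤_       : Carrier → Carrier → Set ℓ
    +-assoc   : ∀ x y z → (x + y) + z ≡ x + (y + z)
    +-comm    : ∀ x y → x + y ≡ y + x
    +-identityˡ : ∀ x → 0# + x ≡ x
    -‿inverseˡ : ∀ x → (- x) + x ≡ 0#
    ≤-refl    : ∀ {x} → x ≤ x
    ≤-trans   : ∀ {x y z} → x ≤ y → y ≤ z → x ≤ z
    ≤-antisym : ∀ {x y} → x ≤ y → y ≤ x → x ≡ y
    ≤-total   : ∀ x y → x ≤ y ⊎ y ≤ x
    +-monoˡ-≤ : ∀ {x y} z → x ≤ y → x + z ≤ y + z

  -- n · x  =  x + x + ... + x  (n times);  this is the real product K·n.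
  _·ℕ_ : ℕ → Carrier → Carrier
  zero  ·ℕ x = 0#
  suc n ·ℕ x = x + (n ·ℕ x)

-- Simple graphs on the vertex set V = Fin n, in a canonical encoding:
-- a graph on Fin (suc n) is the adjacency row of vertex zero to the
-- vertices suc j, together with a graph on the remaining vertices.
-- This is in bijection with the simple graphs on Fin n (G(V)).

Graph : ℕ → Set
Graph zero    = ⊤
Graph (suc n) = Vec Bool n × Graph n

adj : ∀ {n} → Graph n → Fin n → Fin n → Bool
adj (r , g) zero    zero    = false
adj (r , g) zero    (suc j) = lookup r j
adj (r , g) (suc i) zero    = lookup r i
adj (r , g) (suc i) (suc j) = adj g i j

Edge : ∀ {n} → Graph n → Fin n → Fin n → Set
Edge g i j = T (adj g i j)

_∪ᴳ_ : ∀ {n} → Graph n → Graph n → Graph n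
_∪ᴳ_ {zero}  _ _ = tt
_∪ᴳ_ {suc n} (r , g) (s , h) = zipWith _∨_ r s , (g ∪ᴳ h)

EdgeDisjoint : ∀ {n} → Graph n → Graph n → Set
EdgeDisjoint g h = ∀ i j → Edge g i j → Edge h i j → ⊥

Subadditive : ∀ {a ℓ} (R : OrderedAbelianGroup a ℓ) {n} →
              (Graph n → OrderedAbelianGroup.Carrier R) → Set ℓ
Subadditive R {n} f = ∀ (g h : Graph n) → EdgeDisjoint g h →
  OrderedAbelianGroup._≤_ R (f (g ∪ᴳ h)) (OrderedAbelianGroup._+_ R (f g) (f h))

-- S(V): graphs whose edges form a star (all edges share a common vertex c);
-- isolated vertices are allowed.
IsStar : ∀ {n} → Graph n → Set
IsStar {n} g = ∃[ c ] (∀ i j → Edge g i j → i ≡ c ⊎ j ≡ c)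

IsCover : ∀ {n} → Graph n → Subset n → Set
IsCover g U = ∀ i j → Edge g i j → i ∈ U ⊎ j ∈ U

IsCoveringNumber : ∀ {n} → Graph n → ℕ → Set
IsCoveringNumber g t =
  (∃[ U ] (IsCover g U × ∣ U ∣ ≡ t)) × (∀ U → IsCover g U → t ℕ.≤ ∣ U ∣)

HasEdge : ∀ {n} → Graph n → Set
HasEdge g = ∃[ i ] ∃[ j ] Edge g i j

{-# OPTIONS --safe #-}
module Submission where

-- Pick a cover c ∷ cs of G.  The edges of G at c form a star, and the
-- remaining edges are covered by cs; subadditivity over this edge-disjoint
-- split gives f G ≤ K + f (G minus the star at c), and induction on the
-- cover, ending with a graph covered by a single vertex (itself a star),
-- gives f G ≤ |cover| · K.

open import Defs
open import Data.Nat using (ℕ)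
open import Data.Bool using (Bool; true; false; _∨_; _∧_; not; T)
open import Data.Bool.Properties
  using (∧-distribˡ-∨; ∨-inverseʳ; ∧-identityʳ; ∨-comm; T-∧; T-∨)
open import Data.Empty using (⊥-elim)
open import Data.Fin using (Fin; zero; suc; _≟_)
open import Data.Fin.Subset using (Subset; ∣_∣) renaming (_∈_ to _∈ˢ_)
open import Data.List using (List; []; _∷_; [_]; length; map)
open import Data.List.Properties using (length-map)
open import Data.List.Membership.Propositional using (_∈_)
open import Data.List.Membership.Propositional.Properties using (∈-map⁺)
open import Data.List.Relation.Unary.Any using (here; there)
import Data.List.Relation.Unary.Any as Any
open import Data.List.Relation.Unary.Any.Properties using (¬Any[]; singleton⁻)
open import Data.Product using (_×_; _,_; proj₂)
open import Data.Sum using (_⊎_; inj₁; inj₂; [_,_]′)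
import Data.Sum as Sum
open import Data.Vec as Vec using (Vec; []; _∷_; lookup; zipWith; tabulate)
open import Data.Vec.Properties
  using (lookup-zipWith; lookup∘tabulate; tabulate∘lookup; tabulate-cong)
open import Function using (_∘_; Equivalence)
open import Relation.Nullary using (¬_)
open import Relation.Nullary.Decidable using (isYes; toWitness; fromWitness)
open import Relation.Binary.Bundles using (Preorder)
open import Relation.Binary.PropositionalEquality
  using (_≡_; refl; trans; cong; cong₂; subst; subst₂; isEquivalence; module ≡-Reasoning)
open Equivalence using (to; from)

private
  variable
    n : ℕ

lookup-ext : ∀ {A : Set} {m} {r s : Vec A m} → (∀ j → lookup r j ≡ lookup s j) → r ≡ s
lookup-ext {r = r} {s} eq = begin
  r                   ≡⟨ tabulate∘lookup r ⟨
  tabulate (lookup r) ≡⟨ tabulate-cong eq ⟩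
  tabulate (lookup s) ≡⟨ tabulate∘lookup s ⟩
  s                   ∎
  where open ≡-Reasoning

adj-injective : {g h : Graph n} → (∀ i j → adj g i j ≡ adj h i j) → g ≡ h
adj-injective {ℕ.zero}  eq = refl
adj-injective {ℕ.suc n} {r , g} {s , h} eq =
  cong₂ _,_ (lookup-ext (eq zero ∘ suc)) (adj-injective (λ i j → eq (suc i) (suc j)))

adj-∪ᴳ : (g h : Graph n) → ∀ i j → adj (g ∪ᴳ h) i j ≡ adj g i j ∨ adj h i j
adj-∪ᴳ (r , g) (s , h) zero    zero    = refl
adj-∪ᴳ (r , g) (s , h) zero    (suc j) = lookup-zipWith _∨_ j r s
adj-∪ᴳ (r , g) (s , h) (suc i) zero    = lookup-zipWith _∨_ i r s
adj-∪ᴳ (r , g) (s , h) (suc i) (suc j) = adj-∪ᴳ g h i j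

SymmetricPredicate : (Fin n → Fin n → Bool) → Set
SymmetricPredicate p = ∀ i j → p i j ≡ p j i

SymmetricPredicate-not : ∀ {p : Fin n → Fin n → Bool} → SymmetricPredicate p →
                         SymmetricPredicate (λ i j → not (p i j))
SymmetricPredicate-not p-sym i j = cong not (p-sym i j)

-- Only p i j with i < j is consulted, so filterᴳ p keeps exactly the edges
-- satisfying p only when p is symmetric.
filterᴳ : (Fin n → Fin n → Bool) → Graph n → Graph n
filterᴳ {ℕ.zero}  p g       = g
filterᴳ {ℕ.suc n} p (r , g) =
  zipWith _∧_ r (tabulate (p zero ∘ suc)) , filterᴳ (λ i j → p (suc i) (suc j)) g

adj-filterᴳ : ∀ {p} → SymmetricPredicate p → (g : Graph n) →
               ∀ i j → adj (filterᴳ p g) i j ≡ adj g i j ∧ p i j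
adj-filterᴳ p-sym (r , g) zero zero = refl
adj-filterᴳ {p = p} p-sym (r , g) zero (suc j) = begin
  lookup (zipWith _∧_ r (tabulate (p zero ∘ suc))) j ≡⟨ lookup-zipWith _∧_ j r _ ⟩
  lookup r j ∧ lookup (tabulate (p zero ∘ suc)) j    ≡⟨ cong (lookup r j ∧_) (lookup∘tabulate _ j) ⟩
  lookup r j ∧ p zero (suc j)                        ∎
  where open ≡-Reasoning
adj-filterᴳ {p = p} p-sym (r , g) (suc i) zero = begin
  adj (filterᴳ p (r , g)) zero (suc i) ≡⟨ adj-filterᴳ p-sym (r , g) zero (suc i) ⟩
  lookup r i ∧ p zero (suc i)          ≡⟨ cong (lookup r i ∧_) (p-sym zero (suc i)) ⟩
  lookup r i ∧ p (suc i) zero          ∎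
  where open ≡-Reasoning
adj-filterᴳ p-sym (r , g) (suc i) (suc j) =
  adj-filterᴳ (λ i j → p-sym (suc i) (suc j)) g i j

Edge-filterᴳ⁻ : ∀ {p} → SymmetricPredicate p → (g : Graph n) → ∀ i j →
                Edge (filterᴳ p g) i j → Edge g i j × T (p i j)
Edge-filterᴳ⁻ p-sym g i j e = to T-∧ (subst T (adj-filterᴳ p-sym g i j) e)

filterᴳ-∪ᴳ-filterᴳ-not : ∀ {p} → SymmetricPredicate p → (g : Graph n) →
                         filterᴳ p g ∪ᴳ filterᴳ (λ i j → not (p i j)) g ≡ g
filterᴳ-∪ᴳ-filterᴳ-not {p = p} p-sym g = adj-injective λ i j → begin
  adj (filterᴳ p g ∪ᴳ filterᴳ (λ i j → not (p i j)) g) i j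
    ≡⟨ adj-∪ᴳ _ _ i j ⟩
  adj (filterᴳ p g) i j ∨ adj (filterᴳ (λ i j → not (p i j)) g) i j
    ≡⟨ cong₂ _∨_ (adj-filterᴳ p-sym g i j)
                 (adj-filterᴳ (SymmetricPredicate-not p-sym) g i j) ⟩
  (adj g i j ∧ p i j) ∨ (adj g i j ∧ not (p i j))
    ≡⟨ ∧-distribˡ-∨ (adj g i j) (p i j) (not (p i j)) ⟨
  adj g i j ∧ (p i j ∨ not (p i j))
    ≡⟨ cong (adj g i j ∧_) (∨-inverseʳ (p i j)) ⟩
  adj g i j ∧ true
    ≡⟨ ∧-identityʳ (adj g i j) ⟩
  adj g i j ∎
  where open ≡-Reasoning

T-not⇒¬T : ∀ {b} → T (not b) → ¬ T b
T-not⇒¬T {true}  ()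
T-not⇒¬T {false} _ ()

filterᴳ-disjoint-filterᴳ-not : ∀ {p} → SymmetricPredicate p → (g : Graph n) →
                               EdgeDisjoint (filterᴳ p g) (filterᴳ (λ i j → not (p i j)) g)
filterᴳ-disjoint-filterᴳ-not p-sym g i j e e′ =
  T-not⇒¬T (proj₂ (Edge-filterᴳ⁻ (SymmetricPredicate-not p-sym) g i j e′))
           (proj₂ (Edge-filterᴳ⁻ p-sym g i j e))

incident : Fin n → Fin n → Fin n → Bool
incident c i j = isYes (i ≟ c) ∨ isYes (j ≟ c)

incident-sym : (c : Fin n) → SymmetricPredicate (incident c)
incident-sym c i j = ∨-comm (isYes (i ≟ c)) (isYes (j ≟ c))

incident⁺ : ∀ {c i j : Fin n} → i ≡ c ⊎ j ≡ c → T (incident c i j)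
incident⁺ {c = c} {i} {j} = from (T-∨ {isYes (i ≟ c)}) ∘ Sum.map fromWitness fromWitness

incident⁻ : ∀ {c i j : Fin n} → T (incident c i j) → i ≡ c ⊎ j ≡ c
incident⁻ {c = c} {i} {j} = Sum.map toWitness toWitness ∘ to (T-∨ {isYes (i ≟ c)})

starAt : Fin n → Graph n → Graph n
starAt c = filterᴳ (incident c)

awayFrom : Fin n → Graph n → Graph n
awayFrom c = filterᴳ (λ i j → not (incident c i j))

starAt-isStar : (c : Fin n) (g : Graph n) → IsStar (starAt c g)
starAt-isStar c g = c , λ i j e →
  incident⁻ (proj₂ (Edge-filterᴳ⁻ (incident-sym c) g i j e))

starAt-∪ᴳ-awayFrom : (c : Fin n) (g : Graph n) → starAt c g ∪ᴳ awayFrom c g ≡ g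
starAt-∪ᴳ-awayFrom c = filterᴳ-∪ᴳ-filterᴳ-not (incident-sym c)

starAt-disjoint-awayFrom : (c : Fin n) (g : Graph n) → EdgeDisjoint (starAt c g) (awayFrom c g)
starAt-disjoint-awayFrom c = filterᴳ-disjoint-filterᴳ-not (incident-sym c)

CoveredBy : Graph n → List (Fin n) → Set
CoveredBy g cs = ∀ i j → Edge g i j → i ∈ cs ⊎ j ∈ cs

coveredBy-[]⇒¬HasEdge : {g : Graph n} → CoveredBy g [] → ¬ HasEdge g
coveredBy-[]⇒¬HasEdge cover (i , j , e) = [ ¬Any[] , ¬Any[] ]′ (cover i j e)

coveredBy-[_]⇒isStar : ∀ c {g : Graph n} → CoveredBy g [ c ] → IsStar g
coveredBy-[ c ]⇒isStar cover = c , λ i j e → Sum.map singleton⁻ singleton⁻ (cover i j e)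

awayFrom-coveredBy : ∀ {c cs} {g : Graph n} → CoveredBy g (c ∷ cs) → CoveredBy (awayFrom c g) cs
awayFrom-coveredBy {c = c} {g = g} cover i j e
  with e′ , away ← Edge-filterᴳ⁻ (SymmetricPredicate-not (incident-sym c)) g i j e
  = Sum.map (Any.tail (T-not⇒¬T away ∘ incident⁺ ∘ inj₁))
            (Any.tail (T-not⇒¬T away ∘ incident⁺ ∘ inj₂))
            (cover i j e′)

members : Subset n → List (Fin n)
members []          = []
members (true  ∷ s) = zero ∷ map suc (members s)
members (false ∷ s) = map suc (members s)

length-members : (s : Subset n) → length (members s) ≡ ∣ s ∣
length-members []          = refl
length-members (true  ∷ s) = cong ℕ.suc (trans (length-map suc (members s)) (length-members s))
length-members (false ∷ s) = trans (length-map suc (members s)) (length-members s)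

∈-members : ∀ {s : Subset n} {i} → i ∈ˢ s → i ∈ members s
∈-members {s = true  ∷ s} Vec.here        = here refl
∈-members {s = true  ∷ s} (Vec.there i∈s) = there (∈-map⁺ suc (∈-members i∈s))
∈-members {s = false ∷ s} (Vec.there i∈s) = ∈-map⁺ suc (∈-members i∈s)

isCover⇒coveredBy-members : {g : Graph n} {U : Subset n} → IsCover g U → CoveredBy g (members U)
isCover⇒coveredBy-members cover i j e = Sum.map ∈-members ∈-members (cover i j e)

module OrderedAbelianGroupProperties {a ℓ} (R : OrderedAbelianGroup a ℓ) where
  open OrderedAbelianGroup R

  +-identityʳ : ∀ x → x + 0# ≡ x
  +-identityʳ x = trans (+-comm x 0#) (+-identityˡ x)

  +-monoʳ-≤ : ∀ {x y} z → x ≤ y → z + x ≤ z + y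
  +-monoʳ-≤ {x} {y} z x≤y = subst₂ _≤_ (+-comm x z) (+-comm y z) (+-monoˡ-≤ z x≤y)

  +-mono-≤ : ∀ {x x′ y y′} → x ≤ x′ → y ≤ y′ → x + y ≤ x′ + y′
  +-mono-≤ {x′ = x′} {y} x≤x′ y≤y′ = ≤-trans (+-monoˡ-≤ y x≤x′) (+-monoʳ-≤ x′ y≤y′)

  ≤-preorder : Preorder a a ℓ
  ≤-preorder = record
    { _≈_        = _≡_
    ; _≲_        = _≤_
    ; isPreorder = record
      { isEquivalence = isEquivalence
      ; reflexive     = λ { refl → ≤-refl }
      ; trans         = ≤-trans
      }
    }

module StarBounded {a ℓ} (R : OrderedAbelianGroup a ℓ) {n}
  (f : Graph n → OrderedAbelianGroup.Carrier R) (f-subadditive : Subadditive R f)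
  (K : OrderedAbelianGroup.Carrier R)
  (f-star≤K : ∀ S → IsStar S → OrderedAbelianGroup._≤_ R (f S) K)
  where
  open OrderedAbelianGroup R
  open OrderedAbelianGroupProperties R
  open import Relation.Binary.Reasoning.Preorder ≤-preorder

  coveredBy-∷⇒≤length·K : ∀ c cs (g : Graph n) → CoveredBy g (c ∷ cs) →
                          f g ≤ length (c ∷ cs) ·ℕ K
  coveredBy-∷⇒≤length·K c [] g cover = begin
    f g     ≲⟨ f-star≤K g (coveredBy-[ c ]⇒isStar cover) ⟩
    K       ≡⟨ +-identityʳ K ⟨
    K + 0#  ∎
  coveredBy-∷⇒≤length·K c (d ∷ cs) g cover = begin
    f g
      ≡⟨ cong f (starAt-∪ᴳ-awayFrom c g) ⟨
    f (starAt c g ∪ᴳ awayFrom c g)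
      ≲⟨ f-subadditive _ _ (starAt-disjoint-awayFrom c g) ⟩
    f (starAt c g) + f (awayFrom c g)
      ≲⟨ +-mono-≤ (f-star≤K _ (starAt-isStar c g))
                  (coveredBy-∷⇒≤length·K d cs _ (awayFrom-coveredBy cover)) ⟩
    K + length (d ∷ cs) ·ℕ K
      ∎

  coveredBy⇒≤length·K : ∀ cs (g : Graph n) → HasEdge g → CoveredBy g cs →
                        f g ≤ length cs ·ℕ K
  coveredBy⇒≤length·K []       g edge cover = ⊥-elim (coveredBy-[]⇒¬HasEdge cover edge)
  coveredBy⇒≤length·K (c ∷ cs) g edge cover = coveredBy-∷⇒≤length·K c cs g cover

lemma3p2 : ∀ {a ℓ} (R : OrderedAbelianGroup a ℓ) (n : ℕ)
           (f : Graph n → OrderedAbelianGroup.Carrier R) →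
           Subadditive R f →
           (K : OrderedAbelianGroup.Carrier R) →
           (∀ S → IsStar S → OrderedAbelianGroup._≤_ R (f S) K) →
           ∀ (G : Graph n) (t : ℕ) → HasEdge G → IsCoveringNumber G t →
           OrderedAbelianGroup._≤_ R (f G) (OrderedAbelianGroup._·ℕ_ R t K)
lemma3p2 R n f f-subadditive K f-star≤K G t edge ((U , U-cover , ∣U∣≡t) , _) =
  subst (λ m → f G ≤ m ·ℕ K) (trans (length-members U) ∣U∣≡t)
        (coveredBy⇒≤length·K (members U) G edge (isCover⇒coveredBy-members U-cover))
  where
  open OrderedAbelianGroup R
  open StarBounded R f f-subadditive K f-star≤K
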